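{- Let $H$ be a graph on vertex set $[k]$, let $W$ be the lexicographically first minimum vertex cover of $H$, and let $U_1\subseteq[k]\setminus W$ be the lexicographically first among the inclusion-maximal sets $U\subseteq[k]\setminus W$ for which $H$ contains a matching $M\subseteq U\times W$ of size $|U|$ (covering all of $U$). Then $\mathrm{vc}(H)\le\mathrm{vc}(H[W\cup U_1])$.
   Context: $\mathrm{vc}(\cdot)$ is the minimum size of a vertex cover. For $S\subseteq[k]$, $H[S]$ is the subgraph of $H$ whose edges are those of $H$ with both endpoints in $S$. Lexicographic order on subsets of $[k]$: a set $U$ is lexicographically smaller than a set $V\ne U$ if the smallest element of the symmetric difference of $U$ and $V$ lies in $U$. -}

module Defs where

open import Data.Nat using (ℕ; zero; suc; _⊓_; _<_; _≤_)
open import Data.Bool using (Bool; true; false; _∧_; if_then_else_)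
open import Data.Fin using (Fin; toℕ)
open import Data.Fin.Properties using (all?)
open import Data.Fin.Subset using (Subset; _∈_; _∉_; _⊆_; ∣_∣; inside; outside)
open import Data.Fin.Subset.Properties using (_∈?_)
open import Data.Vec using (Vec; []; _∷_; lookup)
open import Data.List using (List; []; _∷_; _++_; map; length; foldr)
open import Data.List.Relation.Unary.All using (All)
open import Data.List.Relation.Unary.AllPairs using (AllPairs)
open import Data.Product using (_×_; ∃; _,_)
open import Data.Sum using (_⊎_)
open import Relation.Binary.PropositionalEquality using (_≡_; _≢_)
open import Relation.Nullary using (Dec; does; ¬_)
open import Relation.Nullary.Decidable using (_⊎-dec_; _→-dec_)
open import Data.Bool.Properties using (_≟_)

Graph : ℕ → Set
Graph k = Fin k → Fin k → Bool

IsSimple : ∀ {k} → Graph k → Set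
IsSimple {k} H = (∀ u v → H u v ≡ H v u) × (∀ u → H u u ≡ false)

-- H[S]: edges of H with both endpoints in S (vertex set still [k]).
induced : ∀ {k} → Graph k → Subset k → Graph k
induced H S u v = H u v ∧ lookup S u ∧ lookup S v

IsVertexCover : ∀ {k} → Graph k → Subset k → Set
IsVertexCover {k} H C = ∀ (u v : Fin k) → H u v ≡ true → u ∈ C ⊎ v ∈ C

isVertexCover? : ∀ {k} (H : Graph k) (C : Subset k) → Dec (IsVertexCover H C)
isVertexCover? H C =
  all? (λ u → all? (λ v → (H u v ≟ true) →-dec ((u ∈? C) ⊎-dec (v ∈? C))))

allSubsets : ∀ k → List (Subset k)
allSubsets zero = [] ∷ []
allSubsets (suc k) = map (outside ∷_) (allSubsets k) ++ map (inside ∷_) (allSubsets k)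

-- vc(H): minimum size of a vertex cover (the full set [k] is always one).
vc : ∀ {k} → Graph k → ℕ
vc {k} H = foldr (λ C acc → if does (isVertexCover? H C) then ∣ C ∣ ⊓ acc else acc) k (allSubsets k)

IsMinimumVertexCover : ∀ {k} → Graph k → Subset k → Set
IsMinimumVertexCover H C = IsVertexCover H C × (∀ D → IsVertexCover H D → ∣ C ∣ ≤ ∣ D ∣)

_<lex_ : ∀ {k} → Subset k → Subset k → Set
_<lex_ {k} U V = ∃ λ (i : Fin k) → i ∈ U × i ∉ V ×
  (∀ (j : Fin k) → toℕ j < toℕ i → (j ∈ U → j ∈ V) × (j ∈ V → j ∈ U))

IsLexFirst : ∀ {k} → (Subset k → Set) → Subset k → Set
IsLexFirst P S = P S × (∀ T → P T → T ≢ S → S <lex T)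

DisjointFrom : ∀ {k} → Subset k → Subset k → Set
DisjointFrom {k} U W = ∀ (i : Fin k) → i ∈ U → i ∉ W

VertexDisjoint : ∀ {k} → Fin k × Fin k → Fin k × Fin k → Set
VertexDisjoint (a , b) (c , d) = a ≢ c × a ≢ d × b ≢ c × b ≢ d

IsMatchingIn : ∀ {k} → Graph k → Subset k → Subset k → List (Fin k × Fin k) → Set
IsMatchingIn H U W M =
  All (λ { (u , w) → u ∈ U × w ∈ W × H u w ≡ true }) M × AllPairs VertexDisjoint M

Matchable : ∀ {k} → Graph k → Subset k → Subset k → Set
Matchable H W U = DisjointFrom U W ×
  ∃ λ M → IsMatchingIn H U W M × length M ≡ ∣ U ∣

IsInclusionMaximal : ∀ {k} → (Subset k → Set) → Subset k → Set
IsInclusionMaximal P U = P U × (∀ V → P V → U ⊆ V → V ≡ U)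

{-# OPTIONS --safe #-}
module Submission where

-- Let C be a vertex cover of H[W ∪ U] and M a matching of U into W. Since W covers H, the
-- only edges of H that C may miss join A = W ∖ C to R = [k] ∖ (W ∪ U). Grow S ⊆ A along
-- alternating paths: S absorbs every a ∈ A adjacent to R or to the M-partner of a vertex
-- already in S. Every a ∈ S is M-matched, for otherwise flipping M along the alternating
-- path from R to a would match U plus one vertex of R, contradicting the maximality of U;
-- and the partner of a lies in C, which covers the edge between them. Exchanging in C the
-- partners of S for S itself gives a vertex cover of H of size at most |C|.

open import Defs
open import Data.Nat using (ℕ; suc; _⊓_; _≤_; s≤s)
open import Data.Nat.Properties using (≤-refl; ≤-trans; ≤-total; m⊓n≤m; m⊓n≤n; ⊓-glb; n≤1+n)
open import Data.Bool using (true; if_then_else_)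
import Data.Bool as Bool
open import Data.Fin using (Fin; zero; suc; _≟_)
open import Data.Fin.Properties using (any?)
open import Data.Fin.Subset
  using (Subset; _∈_; _∉_; _⊆_; _⊂_; _⊃_; ∣_∣; ⊤; ⊥; ⁅_⁆; _∪_; _-_; inside; outside)
open import Data.Fin.Subset.Properties
  using (∈⊤; ∉⊥; ∣⊤∣≡n; ∪-identityʳ; x∈p∪q⁺; x∈p∪q⁻; x∈⁅x⁆; x∈⁅y⁆⇒x≡y; _∈?_;
         x∈p∧x≢y⇒x∈p-y; x∈p⇒∣p-x∣<∣p∣)
open import Data.Fin.Subset.Induction using (Acc; acc; ⊃-wellFounded)
open import Data.Vec using ([]; _∷_; here; there)
open import Data.Vec.Properties using ([]=⇒lookup)
open import Data.Vec.Functional using (updateAt)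
open import Data.Vec.Functional.Properties using (updateAt-updates; updateAt-minimal)
open import Data.List using (List; []; _∷_; map; foldr; length)
open import Data.List.Properties using (length-map)
open import Data.List.Membership.Propositional using () renaming (_∈_ to _∈ₗ_)
import Data.List.Relation.Unary.Any as Any
open import Data.List.Relation.Unary.Any.Properties using (map⁺; ++⁺ˡ; ++⁺ʳ)
open import Data.List.Relation.Unary.All using (All; []; _∷_)
import Data.List.Relation.Unary.All as All
import Data.List.Relation.Unary.All.Properties as AllP
open import Data.List.Relation.Unary.AllPairs using (AllPairs; []; _∷_)
import Data.List.Relation.Unary.AllPairs as AllPairs
open import Data.Product using (∃; ∃₂; _×_; _,_; proj₁; proj₂)
open import Data.Product.Properties using (≡-dec)
open import Data.Sum using (_⊎_; inj₁; inj₂)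
import Data.Sum as Sum
open import Function using (_∘_; const)
open import Relation.Binary.PropositionalEquality using (_≡_; _≢_; refl; cong; subst; sym; trans)
open import Relation.Nullary using (Dec; does; yes; no; ¬_; ¬?)
open import Relation.Nullary.Decidable using (_×-dec_; _⊎-dec_)
open import Relation.Nullary.Negation using (contradiction)

∣p∪⁅x⁆∣≤1+∣p∣ : ∀ {n} (p : Subset n) (x : Fin n) → ∣ p ∪ ⁅ x ⁆ ∣ ≤ suc ∣ p ∣
∣p∪⁅x⁆∣≤1+∣p∣ (outside ∷ p) zero    rewrite ∪-identityʳ p = ≤-refl
∣p∪⁅x⁆∣≤1+∣p∣ (inside  ∷ p) zero    rewrite ∪-identityʳ p = n≤1+n _
∣p∪⁅x⁆∣≤1+∣p∣ (outside ∷ p) (suc x) = ∣p∪⁅x⁆∣≤1+∣p∣ p x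
∣p∪⁅x⁆∣≤1+∣p∣ (inside  ∷ p) (suc x) = s≤s (∣p∪⁅x⁆∣≤1+∣p∣ p x)

x∉p⇒∣p∪⁅x⁆∣≡1+∣p∣ : ∀ {n} {p : Subset n} {x} → x ∉ p → ∣ p ∪ ⁅ x ⁆ ∣ ≡ suc ∣ p ∣
x∉p⇒∣p∪⁅x⁆∣≡1+∣p∣ {p = outside ∷ p} {zero}  _   rewrite ∪-identityʳ p = refl
x∉p⇒∣p∪⁅x⁆∣≡1+∣p∣ {p = inside  ∷ p} {zero}  x∉p = contradiction here x∉p
x∉p⇒∣p∪⁅x⁆∣≡1+∣p∣ {p = outside ∷ p} {suc x} x∉p = x∉p⇒∣p∪⁅x⁆∣≡1+∣p∣ (x∉p ∘ there)
x∉p⇒∣p∪⁅x⁆∣≡1+∣p∣ {p = inside  ∷ p} {suc x} x∉p = cong suc (x∉p⇒∣p∪⁅x⁆∣≡1+∣p∣ (x∉p ∘ there))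

x∉p⇒p⊂p∪⁅x⁆ : ∀ {n} {p : Subset n} {x} → x ∉ p → p ⊂ p ∪ ⁅ x ⁆
x∉p⇒p⊂p∪⁅x⁆ {x = x} x∉p = (λ y∈p → x∈p∪q⁺ (inj₁ y∈p)) , x , x∈p∪q⁺ (inj₂ (x∈⁅x⁆ x)) , x∉p

x∈p∪⁅y⁆∧x≢y⇒x∈p : ∀ {n} {p : Subset n} {x y} → x ∈ p ∪ ⁅ y ⁆ → x ≢ y → x ∈ p
x∈p∪⁅y⁆∧x≢y⇒x∈p {p = p} {y = y} x∈ x≢y with x∈p∪q⁻ p ⁅ y ⁆ x∈
... | inj₁ x∈p   = x∈p
... | inj₂ x∈⁅y⁆ = contradiction (x∈⁅y⁆⇒x≡y y x∈⁅y⁆) x≢y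

allSubsets-complete : ∀ {k} (p : Subset k) → p ∈ₗ allSubsets k
allSubsets-complete         []            = Any.here refl
allSubsets-complete {suc k} (outside ∷ p) =
  ++⁺ˡ (map⁺ (Any.map (cong (outside ∷_)) (allSubsets-complete p)))
allSubsets-complete {suc k} (inside ∷ p)  =
  ++⁺ʳ (map (outside ∷_) (allSubsets k)) (map⁺ (Any.map (cong (inside ∷_)) (allSubsets-complete p)))

if-does-elim : ∀ {a} {A : Set a} {P : Set} (d : Dec P) (Q : A → Set) {x y : A} →
               (P → Q x) → (¬ P → Q y) → Q (if does d then x else y)
if-does-elim (yes p)  Q onYes onNo = onYes p
if-does-elim (no ¬p)  Q onYes onNo = onNo ¬p

module _ {k} (H : Graph k) where

  private
    keepCover : Subset k → ℕ → ℕ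
    keepCover C m = if does (isVertexCover? H C) then ∣ C ∣ ⊓ m else m

    foldr-≤-cover : ∀ {C} m Cs → IsVertexCover H C → C ∈ₗ Cs → foldr keepCover m Cs ≤ ∣ C ∣
    foldr-≤-cover m (C ∷ Cs) cover (Any.here refl) =
      if-does-elim (isVertexCover? H C) (_≤ ∣ C ∣) (λ _ → m⊓n≤m _ _) (contradiction cover)
    foldr-≤-cover {C} m (C′ ∷ Cs) cover (Any.there C∈Cs) =
      if-does-elim (isVertexCover? H C′) (_≤ ∣ C ∣) (λ _ → ≤-trans (m⊓n≤n _ _) bound) (λ _ → bound)
      where bound = foldr-≤-cover m Cs cover C∈Cs

    CoverOfSize≤ : ℕ → Set
    CoverOfSize≤ m = ∃ λ C → IsVertexCover H C × ∣ C ∣ ≤ m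

    foldr-attained : ∀ Cs → CoverOfSize≤ (foldr keepCover k Cs)
    foldr-attained []       = ⊤ , (λ _ _ _ → inj₁ ∈⊤) , subst (_≤ k) (sym (∣⊤∣≡n k)) ≤-refl
    foldr-attained (C ∷ Cs) with foldr-attained Cs
    ... | C′ , cover′ , C′≤ =
      if-does-elim (isVertexCover? H C) CoverOfSize≤ smaller (λ _ → C′ , cover′ , C′≤)
      where
      smaller : IsVertexCover H C → CoverOfSize≤ (∣ C ∣ ⊓ foldr keepCover k Cs)
      smaller cover with ≤-total ∣ C ∣ ∣ C′ ∣
      ... | inj₁ C≤C′ = C , cover , ⊓-glb ≤-refl (≤-trans C≤C′ C′≤)
      ... | inj₂ C′≤C = C′ , cover′ , ⊓-glb C′≤C C′≤

  vc≤∣cover∣ : ∀ {C} → IsVertexCover H C → vc H ≤ ∣ C ∣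
  vc≤∣cover∣ {C} cover = foldr-≤-cover k (allSubsets k) cover (allSubsets-complete C)

  vc-attained : ∃ λ C → IsVertexCover H C × ∣ C ∣ ≤ vc H
  vc-attained = foldr-attained (allSubsets k)

module _ {a r} {A : Set a} {R : A → A → Set r} where

  allPairs-∈ : ∀ {xs x y} → AllPairs R xs → x ∈ₗ xs → y ∈ₗ xs → x ≡ y ⊎ R x y ⊎ R y x
  allPairs-∈ (_   ∷ _)   (Any.here refl) (Any.here refl) = inj₁ refl
  allPairs-∈ (Rxs ∷ _)   (Any.here refl) (Any.there y∈) = inj₂ (inj₁ (All.lookup Rxs y∈))
  allPairs-∈ (Rxs ∷ _)   (Any.there x∈) (Any.here refl) = inj₂ (inj₂ (All.lookup Rxs x∈))
  allPairs-∈ (_   ∷ Rxs) (Any.there x∈) (Any.there y∈) = allPairs-∈ Rxs x∈ y∈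

  allPairs-map⁺-on : ∀ {b p s} {B : Set b} {P : A → Set p} {S : B → B → Set s} {f : A → B} {xs} →
                     (∀ {x y} → P x → P y → R x y → S (f x) (f y)) →
                     All P xs → AllPairs R xs → AllPairs S (map f xs)
  allPairs-map⁺-on h []         []           = []
  allPairs-map⁺-on h (px ∷ pxs) (Rxs ∷ Rxss) =
    AllP.map⁺ (All.zipWith (λ (py , Rxy) → h px py Rxy) (pxs , Rxs)) ∷ allPairs-map⁺-on h pxs Rxss

_∈dom_ : ∀ {a} {A : Set a} → A → List (A × A) → Set a
u ∈dom M = ∃ λ b → (u , b) ∈ₗ M

_∈img_ : ∀ {a} {A : Set a} → A → List (A × A) → Set a
b ∈img M = ∃ λ u → (u , b) ∈ₗ M

partner : ∀ {k} → List (Fin k × Fin k) → Fin k → Fin k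
partner []            u = u
partner ((v , b) ∷ M) u with v ≟ u
... | yes _ = b
... | no  _ = partner M u

partner-∈ : ∀ {k} {M : List (Fin k × Fin k)} {u b} →
            AllPairs (λ x y → proj₁ x ≢ proj₁ y) M → (u , b) ∈ₗ M → partner M u ≡ b
partner-∈ {u = u} (_ ∷ _) (Any.here refl) with u ≟ u
... | yes _   = refl
... | no u≢u  = contradiction refl u≢u
partner-∈ {M = (v , _) ∷ M} {u} (v≢ ∷ distinct) (Any.there ub∈M) with v ≟ u
... | yes refl = contradiction refl (All.lookup v≢ ub∈M)
... | no  _    = partner-∈ distinct ub∈M

module _ {k} (H : Graph k) (W : Subset k) where

  record IsMatchingOn (P : Fin k → Set) (f : Fin k → Fin k) : Set where
    field
      into      : ∀ {p} → P p → f p ∈ W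
      edge      : ∀ {p} → P p → H p (f p) ≡ true
      injective : ∀ {p p′} → P p → P p′ → f p ≡ f p′ → p ≡ p′

  isMatchingOn-mono : ∀ {P Q f} → (∀ {p} → Q p → P p) → IsMatchingOn P f → IsMatchingOn Q f
  isMatchingOn-mono Q⇒P m = record
    { into = into ∘ Q⇒P ; edge = edge ∘ Q⇒P ; injective = λ Qp Qp′ → injective (Q⇒P Qp) (Q⇒P Qp′) }
    where open IsMatchingOn m

  isMatchingOn-updateAt : ∀ {P Q f q a} → (∀ {p} → Q p → p ≢ q → P p) → IsMatchingOn P f →
                          a ∈ W → H q a ≡ true → (∀ {p} → Q p → p ≢ q → f p ≢ a) →
                          IsMatchingOn Q (updateAt f q (const a))
  isMatchingOn-updateAt {P} {Q} {f} {q} {a} narrow m a∈W qa fresh = record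
    { into = into′ ; edge = edge′ ; injective = injective′ }
    where
    open IsMatchingOn m
    g = updateAt f q (const a)

    g-cases : ∀ p → (p ≡ q × g p ≡ a) ⊎ (p ≢ q × g p ≡ f p)
    g-cases p with p ≟ q
    ... | yes refl = inj₁ (refl , updateAt-updates q f)
    ... | no  p≢q  = inj₂ (p≢q , updateAt-minimal p q f p≢q)

    into′ : ∀ {p} → Q p → g p ∈ W
    into′ {p} Qp with g-cases p
    ... | inj₁ (_ , gp≡a)    = subst (_∈ W) (sym gp≡a) a∈W
    ... | inj₂ (p≢q , gp≡fp) = subst (_∈ W) (sym gp≡fp) (into (narrow Qp p≢q))

    edge′ : ∀ {p} → Q p → H p (g p) ≡ true
    edge′ {p} Qp with g-cases p
    ... | inj₁ (refl , gp≡a) = subst (λ b → H p b ≡ true) (sym gp≡a) qa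
    ... | inj₂ (p≢q , gp≡fp) = subst (λ b → H p b ≡ true) (sym gp≡fp) (edge (narrow Qp p≢q))

    injective′ : ∀ {p p′} → Q p → Q p′ → g p ≡ g p′ → p ≡ p′
    injective′ {p} {p′} Qp Qp′ gp≡gp′ with g-cases p | g-cases p′
    ... | inj₁ (refl , _)    | inj₁ (refl , _)      = refl
    ... | inj₁ (_ , gp≡a)    | inj₂ (p′≢q , gp′≡fp′) =
      contradiction (trans (sym gp′≡fp′) (trans (sym gp≡gp′) gp≡a)) (fresh Qp′ p′≢q)
    ... | inj₂ (p≢q , gp≡fp) | inj₁ (_ , gp′≡a)      =
      contradiction (trans (sym gp≡fp) (trans gp≡gp′ gp′≡a)) (fresh Qp p≢q)
    ... | inj₂ (p≢q , gp≡fp) | inj₂ (p′≢q , gp′≡fp′) =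
      injective (narrow Qp p≢q) (narrow Qp′ p′≢q) (trans (sym gp≡fp) (trans gp≡gp′ gp′≡fp′))

module MatchingFacts {k} (H : Graph k) {U W : Subset k} {M : List (Fin k × Fin k)}
                     (disjoint : DisjointFrom U W) (matching : IsMatchingIn H U W M) where

  open import Data.List.Membership.DecPropositional (≡-dec (_≟_ {k}) (_≟_ {k}))
    using () renaming (_∈?_ to _∈?ₗ_)

  M-edge : ∀ {u a} → (u , a) ∈ₗ M → u ∈ U × a ∈ W × H u a ≡ true
  M-edge = All.lookup (proj₁ matching)

  U≢W : ∀ {u w} → u ∈ U → w ∈ W → u ≢ w
  U≢W u∈U w∈W refl = disjoint _ u∈U w∈W

  M-functional : ∀ {u a b} → (u , a) ∈ₗ M → (u , b) ∈ₗ M → a ≡ b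
  M-functional ua∈M ub∈M with allPairs-∈ (proj₂ matching) ua∈M ub∈M
  ... | inj₁ refl               = refl
  ... | inj₂ (inj₁ (u≢u , _))   = contradiction refl u≢u
  ... | inj₂ (inj₂ (u≢u , _))   = contradiction refl u≢u

  M-injective : ∀ {u v a} → (u , a) ∈ₗ M → (v , a) ∈ₗ M → u ≡ v
  M-injective ua∈M va∈M with allPairs-∈ (proj₂ matching) ua∈M va∈M
  ... | inj₁ refl                     = refl
  ... | inj₂ (inj₁ (_ , _ , _ , a≢a)) = contradiction refl a≢a
  ... | inj₂ (inj₂ (_ , _ , _ , a≢a)) = contradiction refl a≢a

  partner-M : ∀ {u b} → (u , b) ∈ₗ M → partner M u ≡ b
  partner-M = partner-∈ (AllPairs.map proj₁ (proj₂ matching))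

  partner-isMatchingOn : IsMatchingOn H W (_∈dom M) (partner M)
  partner-isMatchingOn = record { into = into ; edge = edge ; injective = injective }
    where
    into : ∀ {u} → u ∈dom M → partner M u ∈ W
    into (_ , ub∈M) rewrite partner-M ub∈M = proj₁ (proj₂ (M-edge ub∈M))

    edge : ∀ {u} → u ∈dom M → H u (partner M u) ≡ true
    edge (_ , ub∈M) rewrite partner-M ub∈M = proj₂ (proj₂ (M-edge ub∈M))

    injective : ∀ {u v} → u ∈dom M → v ∈dom M → partner M u ≡ partner M v → u ≡ v
    injective (_ , ub∈M) (_ , vc∈M) same rewrite partner-M ub∈M | partner-M vc∈M =
      M-injective ub∈M (subst (λ c → (_ , c) ∈ₗ M) (sym same) vc∈M)

  _∈M? : ∀ e → Dec (e ∈ₗ M)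
  e ∈M? = e ∈?ₗ M

  _∈img? : ∀ a → Dec (a ∈img M)
  a ∈img? = any? λ u → (u , a) ∈M?

  Dom⁺ : Fin k → Fin k → Set
  Dom⁺ y p = p ≡ y ⊎ p ∈dom M

  ∪⁅⁆-matchable : ∀ {y f} → y ∉ W → y ∉ U → IsMatchingOn H W (Dom⁺ y) f → length M ≡ ∣ U ∣ →
                  Matchable H W (U ∪ ⁅ y ⁆)
  ∪⁅⁆-matchable {y} {f} y∉W y∉U m ∣M∣≡∣U∣ =
    disjoint′ , M′ , extended , size
    where
    open IsMatchingOn m

    reassign : Fin k × Fin k → Fin k × Fin k
    reassign (u , _) = u , f u

    M′ : List (Fin k × Fin k)
    M′ = (y , f y) ∷ map reassign M

    U⊆U∪⁅y⁆ : U ⊆ U ∪ ⁅ y ⁆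
    U⊆U∪⁅y⁆ u∈U = x∈p∪q⁺ (inj₁ u∈U)

    disjoint′ : DisjointFrom (U ∪ ⁅ y ⁆) W
    disjoint′ i i∈ with x∈p∪q⁻ U ⁅ y ⁆ i∈
    ... | inj₁ i∈U  = disjoint i i∈U
    ... | inj₂ i∈⁅y⁆ rewrite x∈⁅y⁆⇒x≡y y i∈⁅y⁆ = y∉W

    dom : ∀ {u b} → (u , b) ∈ₗ M → Dom⁺ y u
    dom ub∈M = inj₂ (_ , ub∈M)

    root-disjoint : ∀ {e} → e ∈ₗ M → VertexDisjoint (y , f y) (reassign e)
    root-disjoint ub∈M =
      (λ { refl → y∉U (proj₁ (M-edge ub∈M)) }) ,
      (λ { refl → y∉W (into (dom ub∈M)) }) ,
      (λ { fy≡u → U≢W (proj₁ (M-edge ub∈M)) (into (inj₁ refl)) (sym fy≡u) }) ,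
      (λ { fy≡fu → contradiction (injective (inj₁ refl) (dom ub∈M) fy≡fu)
                                 λ { refl → y∉U (proj₁ (M-edge ub∈M)) } })

    reassign-disjoint : ∀ {e e′} → e ∈ₗ M → e′ ∈ₗ M →
                        VertexDisjoint e e′ → VertexDisjoint (reassign e) (reassign e′)
    reassign-disjoint ub∈M vc∈M (u≢v , _) =
      u≢v ,
      (λ u≡fv → U≢W (proj₁ (M-edge ub∈M)) (into (dom vc∈M)) u≡fv) ,
      (λ fu≡v → U≢W (proj₁ (M-edge vc∈M)) (into (dom ub∈M)) (sym fu≡v)) ,
      (λ fu≡fv → u≢v (injective (dom ub∈M) (dom vc∈M) fu≡fv))

    extended : IsMatchingIn H (U ∪ ⁅ y ⁆) W M′
    extended =
      ((x∈p∪q⁺ (inj₂ (x∈⁅x⁆ y)) , into (inj₁ refl) , edge (inj₁ refl))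
        ∷ AllP.map⁺ (All.tabulate λ ub∈M →
            U⊆U∪⁅y⁆ (proj₁ (M-edge ub∈M)) , into (dom ub∈M) , edge (dom ub∈M))) ,
      (AllP.map⁺ (All.tabulate root-disjoint)
        ∷ allPairs-map⁺-on reassign-disjoint (All.tabulate (λ e∈M → e∈M)) (proj₂ matching))

    size : length M′ ≡ ∣ U ∪ ⁅ y ⁆ ∣
    size = trans (cong suc (trans (length-map reassign M) ∣M∣≡∣U∣)) (sym (x∉p⇒∣p∪⁅x⁆∣≡1+∣p∣ y∉U))

module Augmentation {k} (H : Graph k) {U W : Subset k} {M : List (Fin k × Fin k)}
                    (disjoint : DisjointFrom U W) (matching : IsMatchingIn H U W M)
                    (∣M∣≡∣U∣ : length M ≡ ∣ U ∣)
                    (maximal : ∀ V → Matchable H W V → U ⊆ V → V ≡ U) where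

  open MatchingFacts H disjoint matching public

  no-augmentation : ∀ {y f} → y ∉ W → y ∉ U → ¬ IsMatchingOn H W (Dom⁺ y) f
  no-augmentation {y} y∉W y∉U m =
    y∉U (subst (y ∈_) (maximal _ (∪⁅⁆-matchable y∉W y∉U m ∣M∣≡∣U∣) (λ u∈U → x∈p∪q⁺ (inj₁ u∈U)))
                      (x∈p∪q⁺ (inj₂ (x∈⁅x⁆ y))))

  Dom⁺-except : Fin k → Fin k → Fin k → Set
  Dom⁺-except y u p = Dom⁺ y p × p ≢ u

  -- Flipping M along an alternating path from a root outside W ∪ U to u, whose W-vertices
  -- all lie in S, yields `reroute`: it matches the root and all of dom M except u into W,
  -- agrees with M away from the partners of S, and only uses W-vertices matched by M.
  record Rematching (S : Subset k) (u : Fin k) : Set where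
    field
      root        : Fin k
      root∉W      : root ∉ W
      root∉U      : root ∉ U
      reroute     : Fin k → Fin k
      isMatching  : IsMatchingOn H W (Dom⁺-except root u) reroute
      agrees      : ∀ {v b} → (v , b) ∈ₗ M → b ∉ S → reroute v ≡ b
      intoMatched : ∀ {p} → Dom⁺-except root u p → reroute p ∈img M
      released    : ∀ {b} → (u , b) ∈ₗ M → b ∈ S

  rematching-root : ∀ {S q} → q ∉ W → q ∉ U → Rematching S q
  rematching-root {q = q} q∉W q∉U = record
    { root        = q
    ; root∉W      = q∉W
    ; root∉U      = q∉U
    ; reroute     = partner M
    ; isMatching  = isMatchingOn-mono H W inDom partner-isMatchingOn
    ; agrees      = λ vb∈M _ → partner-M vb∈M
    ; intoMatched = intoMatched
    ; released    = λ qb∈M → contradiction (proj₁ (M-edge qb∈M)) q∉U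
    }
    where
    inDom : ∀ {p} → Dom⁺-except q q p → p ∈dom M
    inDom (inj₁ p≡q , p≢q) = contradiction p≡q p≢q
    inDom (inj₂ p∈dom , _) = p∈dom

    intoMatched : ∀ {p} → Dom⁺-except q q p → partner M p ∈img M
    intoMatched d with inDom d
    ... | _ , pb∈M rewrite partner-M pb∈M = _ , pb∈M

  rematching-mono : ∀ {S S′ u} → S ⊆ S′ → Rematching S u → Rematching S′ u
  rematching-mono S⊆S′ r = record
    { Rematching r
    ; agrees   = λ vb∈M b∉S′ → agrees vb∈M (λ b∈S → b∉S′ (S⊆S′ b∈S))
    ; released = λ ub∈M → S⊆S′ (released ub∈M)
    }
    where open Rematching r

  rematching-extend : ∀ {S q a} → Rematching S q → a ∈ W → a ∉ S → H q a ≡ true →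
                      ∃ λ u → (u , a) ∈ₗ M × Rematching (S ∪ ⁅ a ⁆) u
  rematching-extend {S} {q} {a} r a∈W a∉S qa with a ∈img?
  ... | no a∉img = contradiction
          (isMatchingOn-updateAt H W (λ d p≢q → d , p≢q) isMatching a∈W qa
            (λ d p≢q rp≡a → a∉img (subst (_∈img M) rp≡a (intoMatched (d , p≢q)))))
          (no-augmentation root∉W root∉U)
    where open Rematching r
  ... | yes (u , ua∈M) = u , ua∈M , record
    { root        = root
    ; root∉W      = root∉W
    ; root∉U      = root∉U
    ; reroute     = reroute′
    ; isMatching  = isMatchingOn-updateAt H W (λ (d , _) p≢q → d , p≢q) isMatching a∈W qa fresh
    ; agrees      = agrees′
    ; intoMatched = intoMatched′
    ; released    = λ ub∈M → subst (_∈ S ∪ ⁅ a ⁆) (M-functional ua∈M ub∈M) (x∈p∪q⁺ (inj₂ (x∈⁅x⁆ a)))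
    }
    where
    open Rematching r
    reroute′ = updateAt reroute q (const a)

    u≢q : u ≢ q
    u≢q refl = a∉S (released ua∈M)

    fresh : ∀ {p} → Dom⁺-except root u p → p ≢ q → reroute p ≢ a
    fresh (d , p≢u) p≢q rp≡a =
      p≢u (IsMatchingOn.injective isMatching (d , p≢q) (inj₂ (a , ua∈M) , u≢q)
            (trans rp≡a (sym (agrees ua∈M a∉S))))

    agrees′ : ∀ {v b} → (v , b) ∈ₗ M → b ∉ S ∪ ⁅ a ⁆ → reroute′ v ≡ b
    agrees′ {v} vb∈M b∉S′ = trans (updateAt-minimal v q reroute v≢q) (agrees vb∈M b∉S)
      where
      b∉S : _ ∉ S
      b∉S b∈S = b∉S′ (x∈p∪q⁺ (inj₁ b∈S))
      v≢q : v ≢ q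
      v≢q refl = b∉S (released vb∈M)

    intoMatched′ : ∀ {p} → Dom⁺-except root u p → reroute′ p ∈img M
    intoMatched′ {p} (d , _) with p ≟ q
    ... | yes refl = subst (_∈img M) (sym (updateAt-updates q reroute)) (u , ua∈M)
    ... | no  p≢q  = subst (_∈img M) (sym (updateAt-minimal p q reroute p≢q)) (intoMatched (d , p≢q))

induced-edge : ∀ {k} {H : Graph k} {S u v} → H u v ≡ true → u ∈ S → v ∈ S → induced H S u v ≡ true
induced-edge {S = S} {u} {v} uv u∈S v∈S
  rewrite uv | []=⇒lookup {xs = S} {i = u} u∈S | []=⇒lookup {xs = S} {i = v} v∈S = refl

module CoverConstruction {k} (H : Graph k) (symmetric : ∀ u v → H u v ≡ H v u)
                         {U W : Subset k} {M : List (Fin k × Fin k)}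
                         (disjoint : DisjointFrom U W) (matching : IsMatchingIn H U W M)
                         (∣M∣≡∣U∣ : length M ≡ ∣ U ∣) (maximal : ∀ V → Matchable H W V → U ⊆ V → V ≡ U)
                         (W-cover : IsVertexCover H W)
                         {C : Subset k} (C-cover : IsVertexCover (induced H (W ∪ U)) C) where

  open Augmentation H disjoint matching ∣M∣≡∣U∣ maximal

  C-covers : ∀ {u v} → H u v ≡ true → u ∈ W ⊎ u ∈ U → v ∈ W ⊎ v ∈ U → u ∈ C ⊎ v ∈ C
  C-covers uv u∈ v∈ = C-cover _ _ (induced-edge {H = H} uv (x∈p∪q⁺ u∈) (x∈p∪q⁺ v∈))

  Exposed : Subset k → Fin k → Set
  Exposed S q = (q ∉ W × q ∉ U) ⊎ ∃ λ a → a ∈ S × (q , a) ∈ₗ M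

  Violation : Subset k → Fin k → Fin k → Set
  Violation S a q = a ∈ W × a ∉ C × a ∉ S × H q a ≡ true × Exposed S q

  Needed : Subset k → Fin k → Set
  Needed S v = (v ∈ W × (v ∈ C ⊎ v ∈ S)) ⊎ (v ∈ U × v ∈ C × (∀ {a} → (v , a) ∈ₗ M → a ∉ S))

  -- D stands for (C ∖ partners of S) ∪ S: each step puts a vertex a into S and exchanges
  -- its partner, which lies in C, for a.
  record State : Set where
    field
      S D         : Subset k
      rematchable : ∀ {u a} → (u , a) ∈ₗ M → a ∈ S → Rematching S u
      needed      : ∀ {v} → Needed S v → v ∈ D
      ∣D∣≤∣C∣     : ∣ D ∣ ≤ ∣ C ∣

  initial : State
  initial = record
    { S           = ⊥
    ; D           = C
    ; rematchable = λ _ a∈⊥ → contradiction a∈⊥ ∉⊥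
    ; needed      = needed
    ; ∣D∣≤∣C∣     = ≤-refl
    }
    where
    needed : ∀ {v} → Needed ⊥ v → v ∈ C
    needed (inj₁ (_ , inj₁ v∈C)) = v∈C
    needed (inj₁ (_ , inj₂ v∈⊥)) = contradiction v∈⊥ ∉⊥
    needed (inj₂ (_ , v∈C , _))  = v∈C

  violation? : ∀ S → Dec (∃₂ (Violation S))
  violation? S = any? λ a → any? λ q →
    a ∈? W ×-dec ¬? (a ∈? C) ×-dec ¬? (a ∈? S) ×-dec H q a Bool.≟ true ×-dec
    ((¬? (q ∈? W) ×-dec ¬? (q ∈? U)) ⊎-dec any? (λ a′ → a′ ∈? S ×-dec (q , a′) ∈M?))

  needed-after-swap : ∀ {S u a v} → (u , a) ∈ₗ M → Needed (S ∪ ⁅ a ⁆) v → v ≢ a → Needed S v × v ≢ u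
  needed-after-swap ua∈M (inj₁ (v∈W , inj₁ v∈C)) _ =
    inj₁ (v∈W , inj₁ v∈C) , U≢W (proj₁ (M-edge ua∈M)) v∈W ∘ sym
  needed-after-swap ua∈M (inj₁ (v∈W , inj₂ v∈S′)) v≢a =
    inj₁ (v∈W , inj₂ (x∈p∪⁅y⁆∧x≢y⇒x∈p v∈S′ v≢a)) , U≢W (proj₁ (M-edge ua∈M)) v∈W ∘ sym
  needed-after-swap {a = a} ua∈M (inj₂ (v∈U , v∈C , unmatched′)) _ =
    inj₂ (v∈U , v∈C , λ vb∈M b∈S → unmatched′ vb∈M (x∈p∪q⁺ (inj₁ b∈S))) ,
    λ { refl → unmatched′ ua∈M (x∈p∪q⁺ (inj₂ (x∈⁅x⁆ a))) }

  exposed-rematching : ∀ (st : State) {q} → Exposed (State.S st) q → Rematching (State.S st) q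
  exposed-rematching st (inj₁ (q∉W , q∉U))       = rematching-root q∉W q∉U
  exposed-rematching st (inj₂ (_ , a′∈S , qa′∈M)) = State.rematchable st qa′∈M a′∈S

  step : ∀ (st : State) {a q} → Violation (State.S st) a q → ∃ λ st′ → State.S st ⊂ State.S st′
  step st {a} (a∈W , a∉C , a∉S , qa , exposed)
    with rematching-extend (exposed-rematching st exposed) a∈W a∉S qa
  ... | u , ua∈M , r = record
    { S = S ∪ ⁅ a ⁆ ; D = (D - u) ∪ ⁅ a ⁆ ; rematchable = rematchable′ ; needed = needed′
    ; ∣D∣≤∣C∣ = ≤-trans (∣p∪⁅x⁆∣≤1+∣p∣ (D - u) a) (≤-trans (x∈p⇒∣p-x∣<∣p∣ u∈D) ∣D∣≤∣C∣) }
    , x∉p⇒p⊂p∪⁅x⁆ a∉S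
    where
    open State st
    u∈D : u ∈ D
    u∈D with M-edge ua∈M
    ... | u∈U , _ , ua with C-covers ua (inj₂ u∈U) (inj₁ a∈W)
    ...   | inj₁ u∈C = needed (inj₂ (u∈U , u∈C , λ ub∈M → subst (_∉ S) (M-functional ua∈M ub∈M) a∉S))
    ...   | inj₂ a∈C = contradiction a∈C a∉C

    rematchable′ : ∀ {v b} → (v , b) ∈ₗ M → b ∈ S ∪ ⁅ a ⁆ → Rematching (S ∪ ⁅ a ⁆) v
    rematchable′ {b = b} vb∈M b∈S′ with x∈p∪q⁻ S ⁅ a ⁆ b∈S′
    ... | inj₁ b∈S = rematching-mono (λ x∈S → x∈p∪q⁺ (inj₁ x∈S)) (rematchable vb∈M b∈S)
    ... | inj₂ b∈⁅a⁆ rewrite x∈⁅y⁆⇒x≡y a b∈⁅a⁆ | M-injective vb∈M ua∈M = r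

    needed′ : ∀ {v} → Needed (S ∪ ⁅ a ⁆) v → v ∈ (D - u) ∪ ⁅ a ⁆
    needed′ {v} n with v ≟ a
    ... | yes refl = x∈p∪q⁺ (inj₂ (x∈⁅x⁆ a))
    ... | no  v≢a  with needed-after-swap ua∈M n v≢a
    ...   | n′ , v≢u = x∈p∪q⁺ (inj₁ (x∈p∧x≢y⇒x∈p-y (needed n′) v≢u))

  closed-from-W : ∀ (st : State) → ¬ ∃₂ (Violation (State.S st)) →
                  ∀ {p q} → p ∈ W → H p q ≡ true → p ∈ State.D st ⊎ q ∈ State.D st
  closed-from-W st closed {p} {q} p∈W pq with p ∈? C | p ∈? State.S st
  ... | yes p∈C | _       = inj₁ (State.needed st (inj₁ (p∈W , inj₁ p∈C)))
  ... | no _    | yes p∈S = inj₁ (State.needed st (inj₁ (p∈W , inj₂ p∈S)))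
  ... | no p∉C  | no p∉S  = inj₂ (needed q-needed)
    where
    open State st
    violation : Exposed S q → ∃₂ (Violation S)
    violation e = p , q , p∈W , p∉C , p∉S , trans (symmetric q p) pq , e
    in-C : q ∈ W ⊎ q ∈ U → q ∈ C
    in-C q∈ with C-covers pq (inj₁ p∈W) q∈
    ... | inj₁ p∈C = contradiction p∈C p∉C
    ... | inj₂ q∈C = q∈C
    q-needed : Needed S q
    q-needed with q ∈? W | q ∈? U
    ... | yes q∈W | _       = inj₁ (q∈W , inj₁ (in-C (inj₁ q∈W)))
    ... | no _    | yes q∈U =
      inj₂ (q∈U , in-C (inj₂ q∈U) , λ qb∈M b∈S → closed (violation (inj₂ (_ , b∈S , qb∈M))))
    ... | no q∉W  | no q∉U  = contradiction (violation (inj₁ (q∉W , q∉U))) closed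

  closed-cover : ∀ (st : State) → ¬ ∃₂ (Violation (State.S st)) → IsVertexCover H (State.D st)
  closed-cover st closed u v uv with W-cover u v uv
  ... | inj₁ u∈W = closed-from-W st closed u∈W uv
  ... | inj₂ v∈W = Sum.swap (closed-from-W st closed v∈W (trans (symmetric v u) uv))

  close : ∀ (st : State) → Acc _⊃_ (State.S st) → ∃ λ D → IsVertexCover H D × ∣ D ∣ ≤ ∣ C ∣
  close st (acc larger) with violation? (State.S st)
  ... | no closed          = State.D st , closed-cover st closed , State.∣D∣≤∣C∣ st
  ... | yes (_ , _ , viol) = let (st′ , S⊂S′) = step st viol in close st′ (larger S⊂S′)

  cover-of-size≤ : ∃ λ D → IsVertexCover H D × ∣ D ∣ ≤ ∣ C ∣
  cover-of-size≤ = close initial (⊃-wellFounded ⊥)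

vc≤vc-induced : ∀ {k} (H : Graph k) → (∀ u v → H u v ≡ H v u) →
                ∀ {W U} → IsVertexCover H W → IsInclusionMaximal (Matchable H W) U →
                vc H ≤ vc (induced H (W ∪ U))
vc≤vc-induced H symmetric {W} {U} W-cover ((disjoint , M , matching , ∣M∣≡∣U∣) , maximal)
  with vc-attained (induced H (W ∪ U))
... | C , C-cover , ∣C∣≤vc
  with CoverConstruction.cover-of-size≤ H symmetric disjoint matching ∣M∣≡∣U∣ maximal W-cover C-cover
...   | D , D-cover , ∣D∣≤∣C∣ = ≤-trans (vc≤∣cover∣ H D-cover) (≤-trans ∣D∣≤∣C∣ ∣C∣≤vc)

lemma4p7 : ∀ (k : ℕ) (H : Graph k) → IsSimple H →
    ∀ W → IsLexFirst (IsMinimumVertexCover H) W →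
    ∀ U₁ → IsLexFirst (IsInclusionMaximal (Matchable H W)) U₁ →
    vc H ≤ vc (induced H (W ∪ U₁))
lemma4p7 k H (symmetric , _) W ((W-cover , _) , _) U₁ (maximal , _) =
  vc≤vc-induced H symmetric W-cover maximal
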